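{- Let $q$ be an odd prime power, $n$ an odd positive integer, and $t$ a positive integer. If $h_q(n)=0$, then $h_{q^{2^t}}(n)=0$.
   Context: For a prime power $Q$ and $n\in\mathbb{N}$, with $\tau$ the cyclic shift $(u_1,\dots,u_n)\mapsto(u_n,u_1,\dots,u_{n-1})$ on $\mathbb{F}_Q^n$, a subspace $U$ is cyclically covering if $\bigcup_{i=0}^{n-1}\tau^i(U)=\mathbb{F}_Q^n$, and $h_Q(n)$ is the largest codimension of a cyclically covering subspace of $\mathbb{F}_Q^n$. -}

module Defs where

open import Level using (0ℓ)
open import Data.Nat using (ℕ; zero; suc; _^_)
open import Data.Fin using (Fin; zero; suc; fromℕ; inject₁; toℕ)
open import Data.Product using (Σ; ∃; _×_; _,_)
open import Data.Nat.Primality using (Prime)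
open import Function using (_∘_)
open import Function.Bundles using (_↔_)
open import Relation.Nullary using (¬_)
open import Relation.Binary.PropositionalEquality using (_≡_)
open import Algebra.Structures using (IsCommutativeRing)

IsPrimePower : ℕ → Set
IsPrimePower Q = Σ ℕ λ p → Σ ℕ λ k → Prime p × Q ≡ p ^ suc k

-- A finite field with exactly Q elements (a model of F_Q; unique up to iso).
record FiniteField (Q : ℕ) : Set₁ where
  field
    Carrier : Set
    _+_ _*_ : Carrier → Carrier → Carrier
    -_      : Carrier → Carrier
    0# 1#   : Carrier
    isCommutativeRing : IsCommutativeRing _≡_ _+_ _*_ -_ 0# 1#
    0≢1     : ¬ (0# ≡ 1#)
    inverse : ∀ x → ¬ (x ≡ 0#) → Σ Carrier λ y → x * y ≡ 1#
    enumeration : Fin Q ↔ Carrier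

module _ {Q : ℕ} (F : FiniteField Q) where
  open FiniteField F

  Vec : ℕ → Set
  Vec n = Fin n → Carrier

  cycPred : ∀ {n} → Fin n → Fin n
  cycPred {suc m} zero    = fromℕ m
  cycPred {suc m} (suc i) = inject₁ i

  -- τ (u₁,…,uₙ) = (uₙ,u₁,…,uₙ₋₁)
  τ : ∀ {n} → Vec n → Vec n
  τ u = u ∘ cycPred

  τ^ : ∀ {n} → ℕ → Vec n → Vec n
  τ^ zero    u = u
  τ^ (suc i) u = τ (τ^ i u)

  _≋_ : ∀ {n} → Vec n → Vec n → Set
  u ≋ v = ∀ j → u j ≡ v j

  record IsSubspace {n : ℕ} (U : Vec n → Set) : Set where
    field
      respects : ∀ {u v} → u ≋ v → U u → U v
      zero∈    : U (λ _ → 0#)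
      +-closed : ∀ {u v} → U u → U v → U (λ j → u j + v j)
      ·-closed : ∀ (c : Carrier) {u} → U u → U (λ j → c * u j)

  CyclicallyCovering : ∀ {n} → (Vec n → Set) → Set
  CyclicallyCovering {n} U =
    ∀ (v : Vec n) → Σ (Fin n) λ i → Σ (Vec n) λ u → U u × (τ^ (toℕ i) u ≋ v)

  -- h_Q(n) = 0 : the largest codimension of a cyclically covering subspace is 0,
  -- i.e. every cyclically covering subspace has codimension 0 (is all of F^n).
  hZero : ℕ → Set₁
  hZero n = ∀ (U : Vec n → Set) → IsSubspace U → CyclicallyCovering U → ∀ v → U v

-- Over F = F_q and K = F_{q^m} there is a field embedding φ : F → K. Pulling a cyclically covering
-- subspace U ⊆ K^n back along φ gives a subspace of F^n which is again cyclically covering, since φ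
-- commutes with τ; by h_q(n) = 0 it is all of F^n. So U contains the images of the unit vectors of F^n,
-- and U = K^n.
--
-- The embedding is found without field theory. With one unknown per element of F, the ring
-- homomorphisms F → K are the common zeros in K^q of equations L = R between polynomials with natural
-- coefficients, and the identity of F is a common zero in F^q. Both fields have characteristic p and
-- satisfy x^N = x for N = |K|, so the product of the indicators 1 − (L − R)^(N−1) over all the equations
-- is 1 exactly at common zeros. It does not vanish at a point of F^q, hence neither at a point of K^q:
-- reducing the degree in each unknown below N by x^N = x keeps a nonzero coefficient, and a nonzero
-- polynomial of degree < N has a non-root in K.

module Submission where

open import Defs
open import Data.Nat using (ℕ; _%_; _≤_)
open import Relation.Binary.PropositionalEquality using (_≡_)

open import Level using (0ℓ)
open import Algebra.Bundles using (CommutativeRing; CommutativeMonoid)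
import Algebra.Properties.CommutativeMonoid.Sum as CommutativeMonoidSum
import Algebra.Properties.Monoid as MonoidProperties
import Algebra.Properties.Semiring.Mult
import Algebra.Solver.Ring.NaturalCoefficients.Default as NaturalCoefficients
open import Data.Nat as ℕ using (zero; suc; z≤n; s≤s; _⊔_; >-nonZero)
open import Data.Nat.Properties
  using (<⇒≤; ≤-trans; ≤-reflexive; pred-mono-≤; suc-pred; ⊔-lub; m⊓n≤m; ∸-monoˡ-≤; m+n∸n≡m; ^-*-assoc;
         module ≤-Reasoning)
open import Data.Nat.Divisibility using (_∣_; _∣?_; divides)
open import Data.Nat.GCD using (module Bézout)
open import Data.Nat.Coprimality using (Coprime; coprime-Bézout)
open import Data.Nat.Primality using (Prime; prime⇒irreducible; prime⇒nonZero)
open import Data.Fin as Fin using (Fin; zero; suc; toℕ; lower₁)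
import Data.Fin.Properties as Fin
open import Data.Fin.Properties using (¬∀⟶∃¬)
open import Data.Fin.Permutation using (Permutation; permutation)
open import Data.List using (List; []; _∷_; length; map; tabulate; take; drop)
open import Data.List.Properties using (length-tabulate; length-take; length-drop; length-map)
open import Data.List.Membership.Propositional using (find; lose)
open import Data.List.Relation.Unary.All as All using (All; []; _∷_)
open import Data.List.Relation.Unary.All.Properties using (All¬⇒¬Any) renaming (tabulate⁺ to All-tabulate⁺)
open import Data.List.Relation.Unary.Any using (Any; here; there)
import Data.List.Relation.Unary.Any.Properties as Any
open import Data.List.Relation.Unary.AllPairs using ([]; _∷_)
open import Data.List.Relation.Unary.Unique.Propositional using (Unique)
import Data.List.Relation.Unary.Unique.Propositional.Properties as Unique
open import Data.Vec.Functional using (head; tail) renaming (_∷_ to _◂_)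
open import Data.Product using (∃; _×_; _,_; proj₁; proj₂)
open import Data.Sum using (inj₁; inj₂)
open import Function using (_∘_; id)
open import Function.Bundles using (Inverse)
open import Relation.Nullary using (¬_; yes; no; contradiction)
open import Relation.Nullary.Decidable using (map′)
open import Relation.Binary.Definitions using (DecidableEquality)
open import Relation.Binary.PropositionalEquality
  using (_≢_; _≗_; refl; sym; trans; cong; cong₂; subst; module ≡-Reasoning)

module FieldProperties {Q : ℕ} (F : FiniteField Q) where
  open FiniteField F public using (0≢1; inverse)

  commutativeRing : CommutativeRing 0ℓ 0ℓ
  commutativeRing = record { isCommutativeRing = FiniteField.isCommutativeRing F }

  open CommutativeRing commutativeRing public hiding (refl; sym; trans; reflexive; zero)
  module Mult = Algebra.Properties.Semiring.Mult semiring
  open import Algebra.Properties.Semiring.Exp semiring public using (_^_; ^-assocʳ)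
  open import Algebra.Properties.Group +-group using (identityˡ-unique)
  open NaturalCoefficients commutativeSemiring public using (solve; _:=_; con; _:+_; _:*_)
  open import Algebra.Properties.CommutativeSemigroup *-commutativeSemigroup public
    using () renaming (x∙yz≈y∙xz to x*[y*z]≡y*[x*z])
  module +-Monoid = MonoidProperties +-monoid
  module *-Monoid = MonoidProperties *-monoid
  module Sum = CommutativeMonoidSum +-commutativeMonoid
  module Product = CommutativeMonoidSum *-commutativeMonoid

  element : Fin Q → Carrier
  element = Inverse.to (FiniteField.enumeration F)

  index : Carrier → Fin Q
  index = Inverse.from (FiniteField.enumeration F)

  element-index : ∀ x → element (index x) ≡ x
  element-index = Inverse.strictlyInverseˡ (FiniteField.enumeration F)

  index-element : ∀ i → index (element i) ≡ i
  index-element = Inverse.strictlyInverseʳ (FiniteField.enumeration F)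

  index-injective : ∀ {x y} → index x ≡ index y → x ≡ y
  index-injective {x} {y} e = trans (sym (element-index x)) (trans (cong element e) (element-index y))

  element-injective : ∀ {i j} → element i ≡ element j → i ≡ j
  element-injective {i} {j} e =
    trans (sym (index-element i)) (trans (cong index e) (index-element j))

  infix 4 _≟_
  _≟_ : DecidableEquality Carrier
  x ≟ y = map′ index-injective (cong index) (index x Fin.≟ index y)

  2≤Q : 2 ≤ Q
  2≤Q = distinct⇒2≤ (index 0#) (index 1#) (0≢1 ∘ index-injective)
    where
    distinct⇒2≤ : ∀ {n} (i j : Fin n) → i ≢ j → 2 ≤ n
    distinct⇒2≤ {suc zero}    zero zero i≢j = contradiction refl i≢j
    distinct⇒2≤ {suc (suc _)} _    _    _   = s≤s (s≤s z≤n)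

  x+y≡y⇒x≡0 : ∀ {x y} → x + y ≡ y → x ≡ 0#
  x+y≡y⇒x≡0 {x} {y} = identityˡ-unique x y

  *-cancelʳ : ∀ {x y} z → z ≢ 0# → x * z ≡ y * z → x ≡ y
  *-cancelʳ {x} {y} z z≢0 xz≡yz = begin
    x             ≡⟨ *-identityʳ x ⟨
    x * 1#        ≡⟨ cong (x *_) z*z⁻¹≡1 ⟨
    x * (z * z⁻¹) ≡⟨ *-assoc x z z⁻¹ ⟨
    x * z * z⁻¹   ≡⟨ cong (_* z⁻¹) xz≡yz ⟩
    y * z * z⁻¹   ≡⟨ *-assoc y z z⁻¹ ⟩
    y * (z * z⁻¹) ≡⟨ cong (y *_) z*z⁻¹≡1 ⟩
    y * 1#        ≡⟨ *-identityʳ y ⟩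
    y             ∎
    where
    open ≡-Reasoning
    z⁻¹ = proj₁ (inverse z z≢0)
    z*z⁻¹≡1 = proj₂ (inverse z z≢0)

  *-nonzero : ∀ {x y} → x ≢ 0# → y ≢ 0# → x * y ≢ 0#
  *-nonzero {x} {y} x≢0 y≢0 xy≡0 = y≢0 (*-cancelʳ x x≢0 (begin
    y * x  ≡⟨ *-comm y x ⟩
    x * y  ≡⟨ xy≡0 ⟩
    0#     ≡⟨ zeroˡ x ⟨
    0# * x ∎))
    where open ≡-Reasoning

  ^-nonzero : ∀ {x} n → x ≢ 0# → x ^ n ≢ 0#
  ^-nonzero zero    x≢0 = 0≢1 ∘ sym
  ^-nonzero (suc n) x≢0 = *-nonzero x≢0 (^-nonzero n x≢0)

  0^n≡0 : ∀ {n} → 1 ≤ n → 0# ^ n ≡ 0#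
  0^n≡0 {suc n} _ = zeroˡ (0# ^ n)

  ^≡0⇒≡0 : ∀ {x} n → x ^ n ≡ 0# → x ≡ 0#
  ^≡0⇒≡0 {x} n xⁿ≡0 with x ≟ 0#
  ... | yes x≡0 = x≡0
  ... | no  x≢0 = contradiction xⁿ≡0 (^-nonzero n x≢0)

  ι : ℕ → Carrier
  ι n = n Mult.× 1#

  ι-homo-+ : ∀ m n → ι (m ℕ.+ n) ≡ ι m + ι n
  ι-homo-+ m n = Mult.×-homo-+ 1# m n

  ι-homo-* : ∀ m n → ι (m ℕ.* n) ≡ ι m * ι n
  ι-homo-* = Mult.×1-homo-*

  ι-homo-^ : ∀ m n → ι (m ℕ.^ n) ≡ ι m ^ n
  ι-homo-^ m zero    = +-identityʳ 1#
  ι-homo-^ m (suc n) = trans (ι-homo-* m (m ℕ.^ n)) (cong (ι m *_) (ι-homo-^ m n))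

  ι-multiple : ∀ {p} → ι p ≡ 0# → ∀ x → ι (x ℕ.* p) ≡ 0#
  ι-multiple {p} ιp≡0 x = trans (ι-homo-* x p) (trans (cong (ι x *_) ιp≡0) (zeroʳ (ι x)))

  ι-∣ : ∀ {p n} → p ∣ n → ι p ≡ 0# → ι n ≡ 0#
  ι-∣ (divides x refl) ιp≡0 = ι-multiple ιp≡0 x

  ι-prime-∣ : ∀ {p n} → Prime p → ι p ≡ 0# → ι n ≡ 0# → p ∣ n
  ι-prime-∣ {p} {n} p-prime ιp≡0 ιn≡0 with p ∣? n
  ... | yes p∣n = p∣n
  ... | no  p∤n = contradiction (Bézout⇒1≡0 (coprime-Bézout coprime)) (0≢1 ∘ sym)
    where
    coprime : Coprime p n
    coprime (d∣p , d∣n) with prime⇒irreducible p-prime d∣p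
    ... | inj₁ d≡1 = d≡1
    ... | inj₂ refl = contradiction d∣n p∤n
    1+a≡b⇒1≡0 : ∀ {a b} → suc a ≡ b → ι a ≡ 0# → ι b ≡ 0# → 1# ≡ 0#
    1+a≡b⇒1≡0 {a} {b} 1+a≡b ιa≡0 ιb≡0 = begin
      1#         ≡⟨ +-identityʳ 1# ⟨
      1# + 0#    ≡⟨ cong (1# +_) ιa≡0 ⟨
      ι (suc a)  ≡⟨ cong ι 1+a≡b ⟩
      ι b        ≡⟨ ιb≡0 ⟩
      0#         ∎
      where open ≡-Reasoning
    Bézout⇒1≡0 : Bézout.Identity 1 p n → 1# ≡ 0#
    Bézout⇒1≡0 (Bézout.+- x y eq) = 1+a≡b⇒1≡0 eq (ι-multiple ιn≡0 y) (ι-multiple ιp≡0 x)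
    Bézout⇒1≡0 (Bézout.-+ x y eq) = 1+a≡b⇒1≡0 eq (ι-multiple ιp≡0 x) (ι-multiple ιn≡0 y)

  ∏-nonzero : ∀ {n} (t : Fin n → Carrier) → (∀ i → t i ≢ 0#) → Product.sum t ≢ 0#
  ∏-nonzero {zero}  t _  = 0≢1 ∘ sym
  ∏-nonzero {suc n} t t≢0 = *-nonzero (t≢0 zero) (∏-nonzero (t ∘ suc) (t≢0 ∘ suc))

  ∏-zero : ∀ {n} (t : Fin n → Carrier) i → t i ≡ 0# → Product.sum t ≡ 0#
  ∏-zero t zero    t₀≡0 = trans (cong (_* Product.sum (t ∘ suc)) t₀≡0) (zeroˡ _)
  ∏-zero t (suc i) tᵢ≡0 = trans (cong (t zero *_) (∏-zero (t ∘ suc) i tᵢ≡0)) (zeroʳ (t zero))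

  ∏-const : ∀ {n} (t : Fin n → Carrier) {a} → (∀ i → t i ≡ a) → Product.sum t ≡ a ^ n
  ∏-const {n} t t≡a = trans (Product.sum-cong-≗ t≡a) (Product.sum-replicate n)

  ∏-replace : ∀ {n} (t : Fin n → Carrier) i {a} → (∀ j → j ≢ i → t j ≡ a) →
              a * Product.sum t ≡ t i * a ^ n
  ∏-replace {suc n} t zero {a} t≡a = begin
    a * (t zero * ∏t′)  ≡⟨ x*[y*z]≡y*[x*z] a (t zero) ∏t′ ⟩
    t zero * (a * ∏t′)  ≡⟨ cong (λ z → t zero * (a * z)) (∏-const (t ∘ suc) (λ j → t≡a (suc j) λ ())) ⟩
    t zero * (a * a ^ n) ∎
    where
    open ≡-Reasoning
    ∏t′ = Product.sum (t ∘ suc)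
  ∏-replace {suc n} t (suc i) {a} t≡a = begin
    a * (t zero * ∏t′)       ≡⟨ x*[y*z]≡y*[x*z] a (t zero) ∏t′ ⟩
    t zero * (a * ∏t′)       ≡⟨ cong₂ _*_ (t≡a zero λ ()) (∏-replace (t ∘ suc) i t∘suc≡a) ⟩
    a * (t (suc i) * a ^ n)  ≡⟨ x*[y*z]≡y*[x*z] a (t (suc i)) (a ^ n) ⟩
    t (suc i) * (a * a ^ n)  ∎
    where
    open ≡-Reasoning
    ∏t′ = Product.sum (t ∘ suc)
    t∘suc≡a : ∀ j → j ≢ i → t (suc j) ≡ a
    t∘suc≡a j j≢i = t≡a (suc j) (j≢i ∘ Fin.suc-injective)

  ∑-select : ∀ {n} (t : Fin n → Carrier) j → (∀ i → i ≢ j → t i ≡ 0#) → Sum.sum t ≡ t j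
  ∑-select {suc n} t j t≡0 = begin
    Sum.sum t                                ≡⟨ Sum.sum-remove {i = j} t ⟩
    t j + Sum.sum (t ∘ Fin.punchIn j)        ≡⟨ cong (t j +_) (Sum.sum-cong-≗ (λ i → t≡0 _ (Fin.punchInᵢ≢i j i))) ⟩
    t j + Sum.sum {n} (λ _ → 0#)             ≡⟨ cong (t j +_) (Sum.sum-replicate-zero n) ⟩
    t j + 0#                                 ≡⟨ +-identityʳ (t j) ⟩
    t j                                      ∎
    where open ≡-Reasoning

  δ : ∀ {n} → Fin n → Fin n → Carrier
  δ i j with i Fin.≟ j
  ... | yes _ = 1#
  ... | no  _ = 0#

  δ-diagonal : ∀ {n} (i : Fin n) → δ i i ≡ 1#
  δ-diagonal i with i Fin.≟ i
  ... | yes _   = refl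
  ... | no  i≢i = contradiction refl i≢i

  δ-offDiagonal : ∀ {n} {i j : Fin n} → i ≢ j → δ i j ≡ 0#
  δ-offDiagonal {i = i} {j} i≢j with i Fin.≟ j
  ... | yes i≡j = contradiction i≡j i≢j
  ... | no  _   = refl

  module _ {c ℓ} (M : CommutativeMonoid c ℓ) (h h⁻¹ : Carrier → Carrier)
           (h∘h⁻¹ : ∀ x → h (h⁻¹ x) ≡ x) (h⁻¹∘h : ∀ x → h⁻¹ (h x) ≡ x) where
    open CommutativeMonoid M using () renaming (_≈_ to _≈ᴹ_; Carrier to A; trans to ≈-trans; reflexive to ≈-reflexive)
    open CommutativeMonoidSum M using (sum; sum-permute; sum-cong-≗)

    sum-bijection : (f : Carrier → A) → sum (f ∘ element) ≈ᴹ sum (f ∘ h ∘ element)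
    sum-bijection f = ≈-trans (sum-permute (f ∘ element) π)
                              (≈-reflexive (sum-cong-≗ (λ j → cong f (element-index (h (element j))))))
      where
      inverse-on-indices : ∀ {g g⁻¹ : Carrier → Carrier} → (∀ x → g (g⁻¹ x) ≡ x) →
                           ∀ j → index (g (element (index (g⁻¹ (element j))))) ≡ j
      inverse-on-indices {g} {g⁻¹} g∘g⁻¹ j = begin
        index (g (element (index (g⁻¹ (element j))))) ≡⟨ cong (index ∘ g) (element-index _) ⟩
        index (g (g⁻¹ (element j)))                   ≡⟨ cong index (g∘g⁻¹ (element j)) ⟩
        index (element j)                             ≡⟨ index-element j ⟩
        j                                             ∎
        where open ≡-Reasoning
      π : Permutation Q Q
      π = permutation (index ∘ h ∘ element) (index ∘ h⁻¹ ∘ element)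
                      (inverse-on-indices {h} {h⁻¹} h∘h⁻¹) (inverse-on-indices {h⁻¹} {h} h⁻¹∘h)

  characteristic : ι Q ≡ 0#
  characteristic = x+y≡y⇒x≡0 (begin
    ι Q + Sum.sum element              ≡⟨ cong (_+ Sum.sum element) (Sum.sum-replicate Q) ⟨
    Sum.sum {Q} (λ _ → 1#) + Sum.sum element ≡⟨ Sum.∑-distrib-+ (λ _ → 1#) element ⟨
    Sum.sum (λ j → 1# + element j)     ≡⟨ sum-bijection +-commutativeMonoid (1# +_) (- 1# +_)
                                            (+-Monoid.cancelˡ (-‿inverseʳ 1#)) (+-Monoid.cancelˡ (-‿inverseˡ 1#)) id ⟨
    Sum.sum element                    ∎)
    where open ≡-Reasoning

  ι-char-of-prime-power : ∀ {p e} → Q ≡ p ℕ.^ e → ι p ≡ 0#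
  ι-char-of-prime-power {p} {e} Q≡pᵉ = ^≡0⇒≡0 e (begin
    ι p ^ e       ≡⟨ ι-homo-^ p e ⟨
    ι (p ℕ.^ e)   ≡⟨ cong ι Q≡pᵉ ⟨
    ι Q           ≡⟨ characteristic ⟩
    0#            ∎)
    where open ≡-Reasoning

  private
    nonzeroPart : Carrier → Carrier
    nonzeroPart y with y ≟ 0#
    ... | yes _ = 1#
    ... | no  _ = y

    nonzeroPart≢0 : ∀ y → nonzeroPart y ≢ 0#
    nonzeroPart≢0 y with y ≟ 0#
    ... | yes _   = 0≢1 ∘ sym
    ... | no  y≢0 = y≢0

    scale : Carrier → Carrier → Carrier
    scale x y with y ≟ 0#
    ... | yes _ = 1#
    ... | no  _ = x

    nonzeroPart-* : ∀ {x} → x ≢ 0# → ∀ y → nonzeroPart (x * y) ≡ scale x y * nonzeroPart y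
    nonzeroPart-* {x} x≢0 y with y ≟ 0# | x * y ≟ 0#
    ... | yes _   | yes _    = sym (*-identityˡ 1#)
    ... | yes y≡0 | no xy≢0  = contradiction (trans (cong (x *_) y≡0) (zeroʳ x)) xy≢0
    ... | no  y≢0 | yes xy≡0 = contradiction xy≡0 (*-nonzero x≢0 y≢0)
    ... | no  _   | no  _    = refl

    -- y ↦ x * y permutes F, turning the product of all nonzeroPart y into itself times ∏ scale x y
    ∏-scale≡1 : ∀ {x} → x ≢ 0# → Product.sum (scale x ∘ element) ≡ 1#
    ∏-scale≡1 {x} x≢0 = sym (*-cancelʳ P (∏-nonzero (nonzeroPart ∘ element) (nonzeroPart≢0 ∘ element)) (begin
      1# * P                                       ≡⟨ *-identityˡ P ⟩
      P                                            ≡⟨ sum-bijection *-commutativeMonoid (x *_) (x⁻¹ *_)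
                                                        (*-Monoid.cancelˡ x*x⁻¹≡1) (*-Monoid.cancelˡ x⁻¹*x≡1) nonzeroPart ⟩
      Product.sum (λ j → nonzeroPart (x * element j)) ≡⟨ Product.sum-cong-≗ (nonzeroPart-* x≢0 ∘ element) ⟩
      Product.sum (λ j → scale x (element j) * nonzeroPart (element j))
                                                   ≡⟨ Product.∑-distrib-+ (scale x ∘ element) (nonzeroPart ∘ element) ⟩
      Product.sum (scale x ∘ element) * P          ∎))
      where
      open ≡-Reasoning
      P = Product.sum (nonzeroPart ∘ element)
      x⁻¹ = proj₁ (inverse x x≢0)
      x*x⁻¹≡1 = proj₂ (inverse x x≢0)
      x⁻¹*x≡1 = trans (*-comm x⁻¹ x) x*x⁻¹≡1

  fermat : ∀ x → x ^ Q ≡ x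
  fermat x with x ≟ 0#
  ... | yes refl = 0^n≡0 (<⇒≤ 2≤Q)
  ... | no  x≢0  = begin
    x ^ Q                           ≡⟨ *-identityˡ (x ^ Q) ⟨
    1# * x ^ Q                      ≡⟨ cong (_* x ^ Q) scale-at-0 ⟨
    scale x (element i₀) * x ^ Q    ≡⟨ ∏-replace (scale x ∘ element) i₀ scale-elsewhere ⟨
    x * Product.sum (scale x ∘ element) ≡⟨ cong (x *_) (∏-scale≡1 x≢0) ⟩
    x * 1#                          ≡⟨ *-identityʳ x ⟩
    x                               ∎
    where
    open ≡-Reasoning
    i₀ = index 0#
    scale-at-0 : scale x (element i₀) ≡ 1#
    scale-at-0 with element i₀ ≟ 0#
    ... | yes _  = refl
    ... | no  ≢0 = contradiction (element-index 0#) ≢0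
    scale-elsewhere : ∀ j → j ≢ i₀ → scale x (element j) ≡ x
    scale-elsewhere j j≢i₀ with element j ≟ 0#
    ... | yes ≡0 = contradiction (trans (sym (index-element j)) (cong index ≡0)) j≢i₀
    ... | no  _  = refl

  fermat-^ : ∀ x m → x ^ (Q ℕ.^ m) ≡ x
  fermat-^ x zero    = *-identityʳ x
  fermat-^ x (suc m) = begin
    x ^ (Q ℕ.* Q ℕ.^ m) ≡⟨ ^-assocʳ x Q (Q ℕ.^ m) ⟨
    (x ^ Q) ^ (Q ℕ.^ m) ≡⟨ cong (_^ (Q ℕ.^ m)) (fermat x) ⟩
    x ^ (Q ℕ.^ m)       ≡⟨ fermat-^ x m ⟩
    x                   ∎
    where open ≡-Reasoning

module UnivariateRoots {Q : ℕ} (F : FiniteField Q) where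
  open FieldProperties F

  horner : List Carrier → Carrier → Carrier
  horner []       x = 0#
  horner (c ∷ cs) x = c + x * horner cs x

  -- synthetic division of c(X) by X − a
  quotient : Carrier → List Carrier → List Carrier
  quotient a []            = []
  quotient a (c ∷ [])      = []
  quotient a (c ∷ c′ ∷ cs) = horner (c′ ∷ cs) a ∷ quotient a (c′ ∷ cs)

  length-quotient : ∀ a cs → length (quotient a cs) ≡ ℕ.pred (length cs)
  length-quotient a []            = refl
  length-quotient a (c ∷ [])      = refl
  length-quotient a (c ∷ c′ ∷ cs) = cong suc (length-quotient a (c′ ∷ cs))

  -- c(x) − c(a) = (x − a) q(x), with both sides moved so that no subtraction occurs
  horner-quotient : ∀ a cs x → horner cs x + a * horner (quotient a cs) x ≡ x * horner (quotient a cs) x + horner cs a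
  horner-quotient a []            x = solve 2 (λ a x → con 0 :+ a :* con 0 := x :* con 0 :+ con 0) refl a x
  horner-quotient a (c ∷ [])      x =
    solve 3 (λ a x c → (c :+ x :* con 0) :+ a :* con 0 := x :* con 0 :+ (c :+ a :* con 0)) refl a x c
  horner-quotient a (c ∷ c′ ∷ cs) x = begin
    (c + x * px) + a * (pa + x * qx) ≡⟨ solve 6 (λ c x px a pa qx → (c :+ x :* px) :+ a :* (pa :+ x :* qx)
                                                   := (c :+ a :* pa) :+ x :* (px :+ a :* qx)) refl c x px a pa qx ⟩
    (c + a * pa) + x * (px + a * qx) ≡⟨ cong (λ u → (c + a * pa) + x * u) (horner-quotient a (c′ ∷ cs) x) ⟩
    (c + a * pa) + x * (x * qx + pa) ≡⟨ solve 5 (λ c x a pa qx → (c :+ a :* pa) :+ x :* (x :* qx :+ pa)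
                                                   := x :* (pa :+ x :* qx) :+ (c :+ a :* pa)) refl c x a pa qx ⟩
    x * (pa + x * qx) + (c + a * pa) ∎
    where
    open ≡-Reasoning
    px = horner (c′ ∷ cs) x
    pa = horner (c′ ∷ cs) a
    qx = horner (quotient a (c′ ∷ cs)) x

  quotient-zero : ∀ a cs → All (_≡ 0#) (quotient a cs) → horner cs a ≡ 0# → All (_≡ 0#) cs
  quotient-zero a []            _           _    = []
  quotient-zero a (c ∷ [])      _           c≡0  =
    trans (sym (trans (cong (c +_) (zeroʳ a)) (+-identityʳ c))) c≡0 ∷ []
  quotient-zero a (c ∷ c′ ∷ cs) (q≡0 ∷ qs≡0) p≡0 =
    trans (sym (trans (cong (λ u → c + a * u) q≡0) (trans (cong (c +_) (zeroʳ a)) (+-identityʳ c)))) p≡0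
    ∷ quotient-zero a (c′ ∷ cs) qs≡0 q≡0

  roots⇒zero : ∀ (S : List Carrier) → Unique S → ∀ cs → length cs ≤ length S →
               All (λ s → horner cs s ≡ 0#) S → All (_≡ 0#) cs
  roots⇒zero []      _              []       _   _            = []
  roots⇒zero (a ∷ S) (a∉S ∷ S-uniq) cs       len (pa≡0 ∷ pS≡0) =
    quotient-zero a cs (roots⇒zero S S-uniq (quotient a cs) len′ (All.zipWith root-of-quotient (a∉S , pS≡0))) pa≡0
    where
    len′ : length (quotient a cs) ≤ length S
    len′ = ≤-trans (≤-reflexive (length-quotient a cs)) (pred-mono-≤ len)
    root-of-quotient : ∀ {s} → a ≢ s × horner cs s ≡ 0# → horner (quotient a cs) s ≡ 0#
    root-of-quotient {s} (a≢s , ps≡0) with horner (quotient a cs) s ≟ 0#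
    ... | yes qs≡0 = qs≡0
    ... | no  qs≢0 = contradiction (*-cancelʳ qs qs≢0 (begin
      a * qs            ≡⟨ +-identityˡ (a * qs) ⟨
      0# + a * qs       ≡⟨ cong (_+ a * qs) ps≡0 ⟨
      horner cs s + a * qs ≡⟨ horner-quotient a cs s ⟩
      s * qs + horner cs a ≡⟨ cong (s * qs +_) pa≡0 ⟩
      s * qs + 0#       ≡⟨ +-identityʳ (s * qs) ⟩
      s * qs            ∎)) a≢s
      where
      open ≡-Reasoning
      qs = horner (quotient a cs) s

  nonRoot : ∀ cs → length cs ≤ Q → Any (_≢ 0#) cs → ∃ λ x → horner cs x ≢ 0#
  nonRoot cs len nonzero =
    let j , pj≢0 = ¬∀⟶∃¬ Q (λ j → horner cs (element j) ≡ 0#) (λ j → horner cs (element j) ≟ 0#) all-roots⇒⊥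
    in element j , pj≢0
    where
    elements = tabulate element
    all-roots⇒⊥ : ¬ (∀ j → horner cs (element j) ≡ 0#)
    all-roots⇒⊥ roots = All¬⇒¬Any (All.map (λ c≡0 c≢0 → c≢0 c≡0) coefficients≡0) nonzero
      where
      coefficients≡0 = roots⇒zero elements (Unique.tabulate⁺ element-injective) cs
                         (subst (length cs ≤_) (sym (length-tabulate element)) len) (All-tabulate⁺ roots)

-- Polynomials with natural coefficients in m variables, in recursive Horner form: an element of
-- Poly (suc m) lists the coefficients (in Poly m) of the powers of the variable with index 0.
Poly : ℕ → Set
Poly zero    = ℕ
Poly (suc m) = List (Poly m)

infixl 6 _+ᴾ_
infixl 7 _*ᴾ_
infixr 8 _^ᴾ_

_+ᴾ_ : ∀ {m} → Poly m → Poly m → Poly m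
_+ᴾ_ {zero}  a        b        = a ℕ.+ b
_+ᴾ_ {suc m} []       bs       = bs
_+ᴾ_ {suc m} (a ∷ as) []       = a ∷ as
_+ᴾ_ {suc m} (a ∷ as) (b ∷ bs) = (a +ᴾ b) ∷ (as +ᴾ bs)

0ᴾ : ∀ {m} → Poly m
0ᴾ {zero}  = 0
0ᴾ {suc m} = []

constᴾ : ∀ {m} → ℕ → Poly m
constᴾ {zero}  n = n
constᴾ {suc m} n = constᴾ n ∷ []

1ᴾ : ∀ {m} → Poly m
1ᴾ = constᴾ 1

_*ᴾ_ : ∀ {m} → Poly m → Poly m → Poly m
_*ᴾ_ {zero}  a        b  = a ℕ.* b
_*ᴾ_ {suc m} []       bs = []
_*ᴾ_ {suc m} (a ∷ as) bs = map (a *ᴾ_) bs +ᴾ (0ᴾ ∷ (as *ᴾ bs))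

varᴾ : ∀ {m} → Fin m → Poly m
varᴾ zero    = 0ᴾ ∷ 1ᴾ ∷ []
varᴾ (suc j) = varᴾ j ∷ []

_^ᴾ_ : ∀ {m} → Poly m → ℕ → Poly m
a ^ᴾ zero  = 1ᴾ
a ^ᴾ suc k = a *ᴾ a ^ᴾ k

∏ᴾ : ∀ {m n} → (Fin n → Poly m) → Poly m
∏ᴾ {n = zero}  f = 1ᴾ
∏ᴾ {n = suc n} f = f zero *ᴾ ∏ᴾ (f ∘ suc)

length-+ᴾ : ∀ {m} (as bs : List (Poly m)) → length (as +ᴾ bs) ≡ length as ℕ.⊔ length bs
length-+ᴾ []       bs       = refl
length-+ᴾ (a ∷ as) []       = refl
length-+ᴾ (a ∷ as) (b ∷ bs) = cong suc (length-+ᴾ as bs)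

module Evaluation {Q : ℕ} (F : FiniteField Q) where
  open FieldProperties F
  open UnivariateRoots F using (horner)

  ⟦_⟧ : ∀ {m} → Poly m → (Fin m → Carrier) → Carrier
  ⟦_⟧ {zero}  n        ρ = ι n
  ⟦_⟧ {suc m} []       ρ = 0#
  ⟦_⟧ {suc m} (c ∷ cs) ρ = ⟦ c ⟧ (tail ρ) + head ρ * ⟦ cs ⟧ ρ

  ⟦+⟧ : ∀ {m} (a b : Poly m) ρ → ⟦ a +ᴾ b ⟧ ρ ≡ ⟦ a ⟧ ρ + ⟦ b ⟧ ρ
  ⟦+⟧ {zero}  a        b        ρ = ι-homo-+ a b
  ⟦+⟧ {suc m} []       bs       ρ = sym (+-identityˡ _)
  ⟦+⟧ {suc m} (a ∷ as) []       ρ = sym (+-identityʳ _)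
  ⟦+⟧ {suc m} (a ∷ as) (b ∷ bs) ρ = begin
    ⟦ a +ᴾ b ⟧ (tail ρ) + head ρ * ⟦ as +ᴾ bs ⟧ ρ
      ≡⟨ cong₂ (λ u v → u + head ρ * v) (⟦+⟧ a b (tail ρ)) (⟦+⟧ as bs ρ) ⟩
    (⟦ a ⟧ (tail ρ) + ⟦ b ⟧ (tail ρ)) + head ρ * (⟦ as ⟧ ρ + ⟦ bs ⟧ ρ)
      ≡⟨ solve 5 (λ A B X C D → (A :+ B) :+ X :* (C :+ D) := (A :+ X :* C) :+ (B :+ X :* D)) refl _ _ _ _ _ ⟩
    (⟦ a ⟧ (tail ρ) + head ρ * ⟦ as ⟧ ρ) + (⟦ b ⟧ (tail ρ) + head ρ * ⟦ bs ⟧ ρ) ∎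
    where open ≡-Reasoning

  ⟦0⟧ : ∀ {m} ρ → ⟦ 0ᴾ {m} ⟧ ρ ≡ 0#
  ⟦0⟧ {zero}  ρ = refl
  ⟦0⟧ {suc m} ρ = refl

  ⟦const⟧ : ∀ {m} n ρ → ⟦ constᴾ {m} n ⟧ ρ ≡ ι n
  ⟦const⟧ {zero}  n ρ = refl
  ⟦const⟧ {suc m} n ρ = trans (cong₂ _+_ (⟦const⟧ n (tail ρ)) (zeroʳ (head ρ))) (+-identityʳ (ι n))

  ⟦1⟧ : ∀ {m} ρ → ⟦ 1ᴾ {m} ⟧ ρ ≡ 1#
  ⟦1⟧ ρ = trans (⟦const⟧ 1 ρ) (+-identityʳ 1#)

  mutual
    ⟦*⟧ : ∀ {m} (a b : Poly m) ρ → ⟦ a *ᴾ b ⟧ ρ ≡ ⟦ a ⟧ ρ * ⟦ b ⟧ ρ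
    ⟦*⟧ {zero}  a        b  ρ = ι-homo-* a b
    ⟦*⟧ {suc m} []       bs ρ = sym (zeroˡ _)
    ⟦*⟧ {suc m} (a ∷ as) bs ρ = begin
      ⟦ map (a *ᴾ_) bs +ᴾ (0ᴾ ∷ (as *ᴾ bs)) ⟧ ρ
        ≡⟨ ⟦+⟧ (map (a *ᴾ_) bs) (0ᴾ ∷ (as *ᴾ bs)) ρ ⟩
      ⟦ map (a *ᴾ_) bs ⟧ ρ + (⟦ 0ᴾ {m} ⟧ (tail ρ) + head ρ * ⟦ as *ᴾ bs ⟧ ρ)
        ≡⟨ cong₂ (λ u v → u + (v + head ρ * ⟦ as *ᴾ bs ⟧ ρ)) (⟦map*⟧ a bs ρ) (⟦0⟧ (tail ρ)) ⟩
      ⟦ a ⟧ (tail ρ) * ⟦ bs ⟧ ρ + (0# + head ρ * ⟦ as *ᴾ bs ⟧ ρ)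
        ≡⟨ cong (λ u → ⟦ a ⟧ (tail ρ) * ⟦ bs ⟧ ρ + (0# + head ρ * u)) (⟦*⟧ as bs ρ) ⟩
      ⟦ a ⟧ (tail ρ) * ⟦ bs ⟧ ρ + (0# + head ρ * (⟦ as ⟧ ρ * ⟦ bs ⟧ ρ))
        ≡⟨ solve 4 (λ A B X C → A :* B :+ (con 0 :+ X :* (C :* B)) := (A :+ X :* C) :* B) refl _ _ _ _ ⟩
      (⟦ a ⟧ (tail ρ) + head ρ * ⟦ as ⟧ ρ) * ⟦ bs ⟧ ρ ∎
      where open ≡-Reasoning

    ⟦map*⟧ : ∀ {m} (a : Poly m) (bs : List (Poly m)) ρ → ⟦ map (a *ᴾ_) bs ⟧ ρ ≡ ⟦ a ⟧ (tail ρ) * ⟦ bs ⟧ ρ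
    ⟦map*⟧ a []       ρ = sym (zeroʳ _)
    ⟦map*⟧ a (b ∷ bs) ρ = begin
      ⟦ a *ᴾ b ⟧ (tail ρ) + head ρ * ⟦ map (a *ᴾ_) bs ⟧ ρ
        ≡⟨ cong₂ (λ u v → u + head ρ * v) (⟦*⟧ a b (tail ρ)) (⟦map*⟧ a bs ρ) ⟩
      ⟦ a ⟧ (tail ρ) * ⟦ b ⟧ (tail ρ) + head ρ * (⟦ a ⟧ (tail ρ) * ⟦ bs ⟧ ρ)
        ≡⟨ solve 4 (λ A B X C → A :* B :+ X :* (A :* C) := A :* (B :+ X :* C)) refl _ _ _ _ ⟩
      ⟦ a ⟧ (tail ρ) * (⟦ b ⟧ (tail ρ) + head ρ * ⟦ bs ⟧ ρ) ∎
      where open ≡-Reasoning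

  ⟦var⟧ : ∀ {m} (j : Fin m) ρ → ⟦ varᴾ j ⟧ ρ ≡ ρ j
  ⟦var⟧ {suc m} zero ρ = begin
    ⟦ 0ᴾ {m} ⟧ (tail ρ) + head ρ * (⟦ 1ᴾ {m} ⟧ (tail ρ) + head ρ * 0#)
      ≡⟨ cong₂ (λ u v → u + head ρ * (v + head ρ * 0#)) (⟦0⟧ (tail ρ)) (⟦1⟧ (tail ρ)) ⟩
    0# + head ρ * (1# + head ρ * 0#)
      ≡⟨ solve 1 (λ X → con 0 :+ X :* (con 1 :+ X :* con 0) := X) refl (head ρ) ⟩
    head ρ ∎
    where open ≡-Reasoning
  ⟦var⟧ {suc m} (suc j) ρ = trans (cong₂ _+_ (⟦var⟧ j (tail ρ)) (zeroʳ (head ρ))) (+-identityʳ (ρ (suc j)))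

  ⟦var+var⟧ : ∀ {m} (i j : Fin m) ρ → ⟦ varᴾ i +ᴾ varᴾ j ⟧ ρ ≡ ρ i + ρ j
  ⟦var+var⟧ i j ρ = trans (⟦+⟧ (varᴾ i) (varᴾ j) ρ) (cong₂ _+_ (⟦var⟧ i ρ) (⟦var⟧ j ρ))

  ⟦var*var⟧ : ∀ {m} (i j : Fin m) ρ → ⟦ varᴾ i *ᴾ varᴾ j ⟧ ρ ≡ ρ i * ρ j
  ⟦var*var⟧ i j ρ = trans (⟦*⟧ (varᴾ i) (varᴾ j) ρ) (cong₂ _*_ (⟦var⟧ i ρ) (⟦var⟧ j ρ))

  ⟦const*⟧ : ∀ {m} n (a : Poly m) ρ → ⟦ constᴾ n *ᴾ a ⟧ ρ ≡ ι n * ⟦ a ⟧ ρ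
  ⟦const*⟧ n a ρ = trans (⟦*⟧ (constᴾ n) a ρ) (cong (_* ⟦ a ⟧ ρ) (⟦const⟧ n ρ))

  ⟦^⟧ : ∀ {m} (a : Poly m) k ρ → ⟦ a ^ᴾ k ⟧ ρ ≡ ⟦ a ⟧ ρ ^ k
  ⟦^⟧ a zero    ρ = ⟦1⟧ ρ
  ⟦^⟧ a (suc k) ρ = trans (⟦*⟧ a (a ^ᴾ k) ρ) (cong (⟦ a ⟧ ρ *_) (⟦^⟧ a k ρ))

  ⟦∏⟧ : ∀ {m n} (f : Fin n → Poly m) ρ → ⟦ ∏ᴾ f ⟧ ρ ≡ Product.sum (λ i → ⟦ f i ⟧ ρ)
  ⟦∏⟧ {n = zero}  f ρ = ⟦1⟧ ρ
  ⟦∏⟧ {n = suc n} f ρ = trans (⟦*⟧ (f zero) (∏ᴾ (f ∘ suc)) ρ) (cong (⟦ f zero ⟧ ρ *_) (⟦∏⟧ (f ∘ suc) ρ))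

  ⟦*⟧-nonzero : ∀ {m} (a b : Poly m) ρ → ⟦ a *ᴾ b ⟧ ρ ≢ 0# → ⟦ a ⟧ ρ ≢ 0# × ⟦ b ⟧ ρ ≢ 0#
  ⟦*⟧-nonzero a b ρ ab≢0 =
    (λ a≡0 → ab≢0 (trans (⟦*⟧ a b ρ) (trans (cong (_* ⟦ b ⟧ ρ) a≡0) (zeroˡ (⟦ b ⟧ ρ))))) ,
    (λ b≡0 → ab≢0 (trans (⟦*⟧ a b ρ) (trans (cong (⟦ a ⟧ ρ *_) b≡0) (zeroʳ (⟦ a ⟧ ρ)))))

  ⟦∏⟧-nonzero : ∀ {m n} (f : Fin n → Poly m) ρ → ⟦ ∏ᴾ f ⟧ ρ ≢ 0# → ∀ i → ⟦ f i ⟧ ρ ≢ 0#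
  ⟦∏⟧-nonzero f ρ ∏≢0 i fᵢ≡0 = ∏≢0 (trans (⟦∏⟧ f ρ) (∏-zero (λ j → ⟦ f j ⟧ ρ) i fᵢ≡0))

  ⟦∏⟧-one : ∀ {m n} (f : Fin n → Poly m) ρ → (∀ i → ⟦ f i ⟧ ρ ≡ 1#) → ⟦ ∏ᴾ f ⟧ ρ ≡ 1#
  ⟦∏⟧-one {n = zero}  f ρ _     = ⟦1⟧ ρ
  ⟦∏⟧-one {n = suc n} f ρ fᵢ≡1 = begin
    ⟦ f zero *ᴾ ∏ᴾ (f ∘ suc) ⟧ ρ        ≡⟨ ⟦*⟧ (f zero) (∏ᴾ (f ∘ suc)) ρ ⟩
    ⟦ f zero ⟧ ρ * ⟦ ∏ᴾ (f ∘ suc) ⟧ ρ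
      ≡⟨ cong₂ _*_ (fᵢ≡1 zero) (⟦∏⟧-one (f ∘ suc) ρ (fᵢ≡1 ∘ suc)) ⟩
    1# * 1#                              ≡⟨ *-identityˡ 1# ⟩
    1#                                   ∎
    where open ≡-Reasoning

  horner-⟦⟧ : ∀ {m} (cs : List (Poly m)) x ρ → horner (map (λ c → ⟦ c ⟧ ρ) cs) x ≡ ⟦ cs ⟧ (x ◂ ρ)
  horner-⟦⟧ []       x ρ = refl
  horner-⟦⟧ (c ∷ cs) x ρ = cong (λ u → ⟦ c ⟧ ρ + x * u) (horner-⟦⟧ cs x ρ)

module Reduction (N : ℕ) (2≤N : 2 ≤ N) where
  -- rewrites X^N·D(X) to X·D(X) in the variable with index 0
  fold : ∀ {m} → List (Poly m) → List (Poly m)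
  fold cs = take N cs +ᴾ (0ᴾ ∷ drop N cs)

  reduce : ∀ {m} → List (Poly m) → List (Poly m)
  reduce []       = []
  reduce (c ∷ cs) = (c ∷ []) +ᴾ fold (0ᴾ ∷ reduce cs)

  length-fold : ∀ {m} (cs : List (Poly m)) → length cs ≤ suc N → length (fold cs) ≤ N
  length-fold cs len≤1+N = begin
    length (fold cs)                            ≡⟨ length-+ᴾ (take N cs) (0ᴾ ∷ drop N cs) ⟩
    length (take N cs) ⊔ suc (length (drop N cs)) ≤⟨ ⊔-lub length-take≤N (≤-trans (s≤s length-drop≤1) 2≤N) ⟩
    N                                           ∎
    where
    open ≤-Reasoning
    length-take≤N : length (take N cs) ≤ N
    length-take≤N = ≤-trans (≤-reflexive (length-take N cs)) (m⊓n≤m N (length cs))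
    length-drop≤1 : length (drop N cs) ≤ 1
    length-drop≤1 = ≤-trans (≤-reflexive (length-drop N cs))
                            (≤-trans (∸-monoˡ-≤ N len≤1+N) (≤-reflexive (m+n∸n≡m 1 N)))

  length-reduce : ∀ {m} (cs : List (Poly m)) → length (reduce cs) ≤ N
  length-reduce []       = z≤n
  length-reduce (c ∷ cs) = begin
    length ((c ∷ []) +ᴾ fold (0ᴾ ∷ reduce cs)) ≡⟨ length-+ᴾ (c ∷ []) (fold (0ᴾ ∷ reduce cs)) ⟩
    1 ⊔ length (fold (0ᴾ ∷ reduce cs))
      ≤⟨ ⊔-lub (≤-trans (s≤s z≤n) 2≤N) (length-fold _ (s≤s (length-reduce cs))) ⟩
    N                                          ∎
    where open ≤-Reasoning

  module _ {Q : ℕ} (F : FiniteField Q) where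
    open FieldProperties F
    open Evaluation F

    ⟦take-drop⟧ : ∀ {m} k (cs : List (Poly m)) ρ → ⟦ cs ⟧ ρ ≡ ⟦ take k cs ⟧ ρ + head ρ ^ k * ⟦ drop k cs ⟧ ρ
    ⟦take-drop⟧ zero    cs       ρ = sym (trans (+-identityˡ _) (*-identityˡ _))
    ⟦take-drop⟧ (suc k) []       ρ = sym (trans (+-identityˡ _) (zeroʳ _))
    ⟦take-drop⟧ (suc k) (c ∷ cs) ρ = begin
      ⟦ c ⟧ (tail ρ) + head ρ * ⟦ cs ⟧ ρ
        ≡⟨ cong (λ u → ⟦ c ⟧ (tail ρ) + head ρ * u) (⟦take-drop⟧ k cs ρ) ⟩
      ⟦ c ⟧ (tail ρ) + head ρ * (⟦ take k cs ⟧ ρ + head ρ ^ k * ⟦ drop k cs ⟧ ρ)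
        ≡⟨ solve 5 (λ A X T P D → A :+ X :* (T :+ P :* D) := (A :+ X :* T) :+ (X :* P) :* D) refl _ _ _ _ _ ⟩
      (⟦ c ⟧ (tail ρ) + head ρ * ⟦ take k cs ⟧ ρ) + (head ρ * head ρ ^ k) * ⟦ drop k cs ⟧ ρ ∎
      where open ≡-Reasoning

    module _ (fermat : ∀ x → x ^ N ≡ x) where
      ⟦fold⟧ : ∀ {m} (cs : List (Poly m)) ρ → ⟦ fold cs ⟧ ρ ≡ ⟦ cs ⟧ ρ
      ⟦fold⟧ {m} cs ρ = begin
        ⟦ take N cs +ᴾ (0ᴾ ∷ drop N cs) ⟧ ρ ≡⟨ ⟦+⟧ (take N cs) (0ᴾ ∷ drop N cs) ρ ⟩
        ⟦ take N cs ⟧ ρ + (⟦ 0ᴾ {m} ⟧ (tail ρ) + head ρ * ⟦ drop N cs ⟧ ρ)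
          ≡⟨ cong (λ u → ⟦ take N cs ⟧ ρ + (u + head ρ * ⟦ drop N cs ⟧ ρ)) (⟦0⟧ (tail ρ)) ⟩
        ⟦ take N cs ⟧ ρ + (0# + head ρ * ⟦ drop N cs ⟧ ρ)
          ≡⟨ cong (⟦ take N cs ⟧ ρ +_) (+-identityˡ _) ⟩
        ⟦ take N cs ⟧ ρ + head ρ * ⟦ drop N cs ⟧ ρ
          ≡⟨ cong (λ u → ⟦ take N cs ⟧ ρ + u * ⟦ drop N cs ⟧ ρ) (fermat (head ρ)) ⟨
        ⟦ take N cs ⟧ ρ + head ρ ^ N * ⟦ drop N cs ⟧ ρ ≡⟨ ⟦take-drop⟧ N cs ρ ⟨
        ⟦ cs ⟧ ρ ∎
        where open ≡-Reasoning

      ⟦reduce⟧ : ∀ {m} (cs : List (Poly m)) ρ → ⟦ reduce cs ⟧ ρ ≡ ⟦ cs ⟧ ρ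
      ⟦reduce⟧     []       ρ = refl
      ⟦reduce⟧ {m} (c ∷ cs) ρ = begin
        ⟦ (c ∷ []) +ᴾ fold (0ᴾ ∷ reduce cs) ⟧ ρ
          ≡⟨ ⟦+⟧ (c ∷ []) (fold (0ᴾ ∷ reduce cs)) ρ ⟩
        (⟦ c ⟧ (tail ρ) + head ρ * 0#) + ⟦ fold (0ᴾ ∷ reduce cs) ⟧ ρ
          ≡⟨ cong ((⟦ c ⟧ (tail ρ) + head ρ * 0#) +_) (⟦fold⟧ (0ᴾ ∷ reduce cs) ρ) ⟩
        (⟦ c ⟧ (tail ρ) + head ρ * 0#) + (⟦ 0ᴾ {m} ⟧ (tail ρ) + head ρ * ⟦ reduce cs ⟧ ρ)
          ≡⟨ cong₂ (λ u v → (⟦ c ⟧ (tail ρ) + head ρ * 0#) + (u + head ρ * v)) (⟦0⟧ (tail ρ)) (⟦reduce⟧ cs ρ) ⟩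
        (⟦ c ⟧ (tail ρ) + head ρ * 0#) + (0# + head ρ * ⟦ cs ⟧ ρ)
          ≡⟨ solve 3 (λ A X C → (A :+ X :* con 0) :+ (con 0 :+ X :* C) := A :+ X :* C) refl _ _ _ ⟩
        ⟦ c ⟧ (tail ρ) + head ρ * ⟦ cs ⟧ ρ ∎
        where open ≡-Reasoning

module Transfer {q N : ℕ} (F : FiniteField q) (K : FiniteField N)
                (fermatᶠ : ∀ x → FieldProperties._^_ F x N ≡ x)
                (char : ∀ n → FieldProperties.ι K n ≡ FieldProperties.0# K →
                              FieldProperties.ι F n ≡ FieldProperties.0# F) where
  private
    module Fᶠ = FieldProperties F
    module Kᶠ = FieldProperties K
  open Evaluation F using () renaming (⟦_⟧ to ⟦_⟧ᶠ)
  open Evaluation K using (horner-⟦⟧) renaming (⟦_⟧ to ⟦_⟧ᴷ)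
  open Reduction N Kᶠ.2≤Q using (reduce; length-reduce; ⟦reduce⟧)
  open UnivariateRoots K using (nonRoot)

  nonzero-coefficient : ∀ {m} (cs : List (Poly m)) ρ → ⟦ cs ⟧ᶠ ρ ≢ Fᶠ.0# →
                        Any (λ c → ⟦ c ⟧ᶠ (tail ρ) ≢ Fᶠ.0#) cs
  nonzero-coefficient []       ρ cs≢0 = contradiction refl cs≢0
  nonzero-coefficient (c ∷ cs) ρ cs≢0 with ⟦ c ⟧ᶠ (tail ρ) Fᶠ.≟ Fᶠ.0#
  ... | no  c≢0 = here c≢0
  ... | yes c≡0 = there (nonzero-coefficient cs ρ λ rest≡0 → cs≢0 (begin
    ⟦ c ⟧ᶠ (tail ρ) Fᶠ.+ head ρ Fᶠ.* ⟦ cs ⟧ᶠ ρ ≡⟨ cong₂ (λ u v → u Fᶠ.+ head ρ Fᶠ.* v) c≡0 rest≡0 ⟩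
    Fᶠ.0# Fᶠ.+ head ρ Fᶠ.* Fᶠ.0#               ≡⟨ Fᶠ.+-identityˡ _ ⟩
    head ρ Fᶠ.* Fᶠ.0#                          ≡⟨ Fᶠ.zeroʳ (head ρ) ⟩
    Fᶠ.0#                                      ∎))
    where open ≡-Reasoning

  -- By induction on the number of unknowns: some coefficient of the reduced polynomial, in the
  -- remaining unknowns, is nonzero at a point ρ′ of K, and at ρ′ the reduced polynomial in the first
  -- unknown has a non-root x in K.
  nonvanishing : ∀ {m} (P : Poly m) ρ → ⟦ P ⟧ᶠ ρ ≢ Fᶠ.0# → ∃ λ ρ′ → ⟦ P ⟧ᴷ ρ′ ≢ Kᶠ.0#
  nonvanishing {zero}  n ρ n≢0 = (λ ()) , n≢0 ∘ char n
  nonvanishing {suc m} P ρ P≢0 = x ◂ ρ′ , P[x◂ρ′]≢0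
    where
    R = reduce P
    R≢0 : ⟦ R ⟧ᶠ ρ ≢ Fᶠ.0#
    R≢0 = P≢0 ∘ trans (sym (⟦reduce⟧ F fermatᶠ P ρ))
    found = find (nonzero-coefficient R ρ R≢0)
    c = proj₁ found
    ρ′c≢0 = nonvanishing c (tail ρ) (proj₂ (proj₂ found))
    ρ′ = proj₁ ρ′c≢0
    Rᴷ = map (λ c → ⟦ c ⟧ᴷ ρ′) R
    length-Rᴷ : length Rᴷ ≤ N
    length-Rᴷ = subst (_≤ N) (sym (length-map _ R)) (length-reduce P)
    nonRoot-Rᴷ = nonRoot Rᴷ length-Rᴷ (Any.map⁺ (lose (proj₁ (proj₂ found)) (proj₂ ρ′c≢0)))
    x = proj₁ nonRoot-Rᴷ
    P[x◂ρ′]≢0 : ⟦ P ⟧ᴷ (x ◂ ρ′) ≢ Kᶠ.0#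
    P[x◂ρ′]≢0 P≡0 = proj₂ nonRoot-Rᴷ (begin
      UnivariateRoots.horner K Rᴷ x ≡⟨ horner-⟦⟧ R x ρ′ ⟩
      ⟦ R ⟧ᴷ (x ◂ ρ′)               ≡⟨ ⟦reduce⟧ K Kᶠ.fermat P (x ◂ ρ′) ⟩
      ⟦ P ⟧ᴷ (x ◂ ρ′)               ≡⟨ P≡0 ⟩
      Kᶠ.0#                          ∎)
      where open ≡-Reasoning

module _ {q N : ℕ} (F : FiniteField q) (K : FiniteField N) where
  private
    module Fᶠ = FieldProperties F
    module Kᶠ = FieldProperties K

  record FieldHom : Set where
    field
      to    : Fᶠ.Carrier → Kᶠ.Carrier
      to-1# : to Fᶠ.1# ≡ Kᶠ.1#
      to-+  : ∀ x y → to (x Fᶠ.+ y) ≡ to x Kᶠ.+ to y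
      to-*  : ∀ x y → to (x Fᶠ.* y) ≡ to x Kᶠ.* to y

    to-0# : to Fᶠ.0# ≡ Kᶠ.0#
    to-0# = Kᶠ.x+y≡y⇒x≡0 (trans (sym (to-+ Fᶠ.0# Fᶠ.0#)) (cong to (Fᶠ.+-identityˡ Fᶠ.0#)))

-- c = p − 1 acts as −1 in characteristic p, so L ≐ᴾ R is 1 − (L − R)^(N−1): where x^N = x, it
-- evaluates to 1 where L = R and to 0 elsewhere.
module Indicator (p N : ℕ) where
  c : ℕ
  c = ℕ.pred p

  infix 4 _≐ᴾ_
  _≐ᴾ_ : ∀ {m} → Poly m → Poly m → Poly m
  L ≐ᴾ R = 1ᴾ +ᴾ constᴾ c *ᴾ (L +ᴾ constᴾ c *ᴾ R) ^ᴾ ℕ.pred N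

  module Semantics {Q : ℕ} (F : FiniteField Q) (p-prime : Prime p) (ιp≡0 : FieldProperties.ι F p ≡ FieldProperties.0# F)
           (2≤N : 2 ≤ N) (x^N≡x : ∀ x → FieldProperties._^_ F x N ≡ x) where
    open FieldProperties F
    open Evaluation F

    x+cx≡0 : ∀ x → x + ι c * x ≡ 0#
    x+cx≡0 x = begin
      x + ι c * x      ≡⟨ solve 2 (λ x y → x :+ y :* x := (con 1 :+ y) :* x) refl x (ι c) ⟩
      ι (suc c) * x    ≡⟨ cong (λ n → ι n * x) (suc-pred p {{prime⇒nonZero p-prime}}) ⟩
      ι p * x          ≡⟨ cong (_* x) ιp≡0 ⟩
      0# * x           ≡⟨ zeroˡ x ⟩
      0#               ∎
      where open ≡-Reasoning

    x+cy≡0⇒x≡y : ∀ {x y} → x + ι c * y ≡ 0# → x ≡ y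
    x+cy≡0⇒x≡y {x} {y} x+cy≡0 = begin
      x                      ≡⟨ +-identityʳ x ⟨
      x + 0#                 ≡⟨ cong (x +_) (x+cx≡0 y) ⟨
      x + (y + ι c * y)      ≡⟨ solve 3 (λ x y z → x :+ (y :+ z :* y) := (x :+ z :* y) :+ y) refl x y (ι c) ⟩
      (x + ι c * y) + y      ≡⟨ cong (_+ y) x+cy≡0 ⟩
      0# + y                 ≡⟨ +-identityˡ y ⟩
      y                      ∎
      where open ≡-Reasoning

    ⟦≐⟧ : ∀ {m} (L R : Poly m) ρ → ⟦ L ≐ᴾ R ⟧ ρ ≡ 1# + ι c * (⟦ L ⟧ ρ + ι c * ⟦ R ⟧ ρ) ^ ℕ.pred N
    ⟦≐⟧ L R ρ = begin
      ⟦ L ≐ᴾ R ⟧ ρ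
        ≡⟨ ⟦+⟧ 1ᴾ _ ρ ⟩
      ⟦ 1ᴾ ⟧ ρ + ⟦ constᴾ c *ᴾ (L +ᴾ constᴾ c *ᴾ R) ^ᴾ ℕ.pred N ⟧ ρ
        ≡⟨ cong₂ _+_ (⟦1⟧ ρ) (⟦const*⟧ c _ ρ) ⟩
      1# + ι c * ⟦ (L +ᴾ constᴾ c *ᴾ R) ^ᴾ ℕ.pred N ⟧ ρ
        ≡⟨ cong (λ u → 1# + ι c * u) (⟦^⟧ _ (ℕ.pred N) ρ) ⟩
      1# + ι c * ⟦ L +ᴾ constᴾ c *ᴾ R ⟧ ρ ^ ℕ.pred N
        ≡⟨ cong (λ u → 1# + ι c * u ^ ℕ.pred N) ⟦L+cR⟧ ⟩
      1# + ι c * (⟦ L ⟧ ρ + ι c * ⟦ R ⟧ ρ) ^ ℕ.pred N ∎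
      where
      open ≡-Reasoning
      ⟦L+cR⟧ : ⟦ L +ᴾ constᴾ c *ᴾ R ⟧ ρ ≡ ⟦ L ⟧ ρ + ι c * ⟦ R ⟧ ρ
      ⟦L+cR⟧ = trans (⟦+⟧ L _ ρ) (cong (⟦ L ⟧ ρ +_) (⟦const*⟧ c R ρ))

    ⟦≐⟧-≡ : ∀ {m} (L R : Poly m) ρ → ⟦ L ⟧ ρ ≡ ⟦ R ⟧ ρ → ⟦ L ≐ᴾ R ⟧ ρ ≡ 1#
    ⟦≐⟧-≡ L R ρ L≡R = begin
      ⟦ L ≐ᴾ R ⟧ ρ                                    ≡⟨ ⟦≐⟧ L R ρ ⟩
      1# + ι c * (⟦ L ⟧ ρ + ι c * ⟦ R ⟧ ρ) ^ ℕ.pred N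
        ≡⟨ cong (λ u → 1# + ι c * (u + ι c * ⟦ R ⟧ ρ) ^ ℕ.pred N) L≡R ⟩
      1# + ι c * (⟦ R ⟧ ρ + ι c * ⟦ R ⟧ ρ) ^ ℕ.pred N
        ≡⟨ cong (λ u → 1# + ι c * u ^ ℕ.pred N) (x+cx≡0 (⟦ R ⟧ ρ)) ⟩
      1# + ι c * 0# ^ ℕ.pred N                         ≡⟨ cong (λ u → 1# + ι c * u) (0^n≡0 (pred-mono-≤ 2≤N)) ⟩
      1# + ι c * 0#                                    ≡⟨ cong (1# +_) (zeroʳ (ι c)) ⟩
      1# + 0#                                          ≡⟨ +-identityʳ 1# ⟩
      1#                                               ∎
      where open ≡-Reasoning

    ⟦≐⟧-≢ : ∀ {m} (L R : Poly m) ρ → ⟦ L ⟧ ρ ≢ ⟦ R ⟧ ρ → ⟦ L ≐ᴾ R ⟧ ρ ≡ 0#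
    ⟦≐⟧-≢ L R ρ L≢R = begin
      ⟦ L ≐ᴾ R ⟧ ρ                 ≡⟨ ⟦≐⟧ L R ρ ⟩
      1# + ι c * d ^ ℕ.pred N      ≡⟨ cong (λ u → 1# + ι c * u) dᴺ⁻¹≡1 ⟩
      1# + ι c * 1#                ≡⟨ x+cx≡0 1# ⟩
      0#                           ∎
      where
      open ≡-Reasoning
      d = ⟦ L ⟧ ρ + ι c * ⟦ R ⟧ ρ
      d≢0 : d ≢ 0#
      d≢0 = L≢R ∘ x+cy≡0⇒x≡y
      dᴺ⁻¹≡1 : d ^ ℕ.pred N ≡ 1#
      dᴺ⁻¹≡1 = *-cancelʳ d d≢0 (begin
        d ^ ℕ.pred N * d  ≡⟨ *-comm _ d ⟩
        d ^ suc (ℕ.pred N) ≡⟨ cong (d ^_) (suc-pred N {{>-nonZero (≤-trans (s≤s z≤n) 2≤N)}}) ⟩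
        d ^ N             ≡⟨ x^N≡x d ⟩
        d                 ≡⟨ *-identityˡ d ⟨
        1# * d            ∎)

    ⟦≐⟧-nonzero : ∀ {m} (L R : Poly m) ρ → ⟦ L ≐ᴾ R ⟧ ρ ≢ 0# → ⟦ L ⟧ ρ ≡ ⟦ R ⟧ ρ
    ⟦≐⟧-nonzero L R ρ ≐≢0 with ⟦ L ⟧ ρ ≟ ⟦ R ⟧ ρ
    ... | yes L≡R = L≡R
    ... | no  L≢R = contradiction (⟦≐⟧-≢ L R ρ L≢R) ≐≢0

module Embedding {q N : ℕ} (F : FiniteField q) (K : FiniteField N) {p : ℕ} (p-prime : Prime p)
                 (ιp≡0ᶠ : FieldProperties.ι F p ≡ FieldProperties.0# F)
                 (ιp≡0ᴷ : FieldProperties.ι K p ≡ FieldProperties.0# K)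
                 (fermatᶠ : ∀ x → FieldProperties._^_ F x N ≡ x) where
  private
    module Fᶠ = FieldProperties F
    module Kᶠ = FieldProperties K
    module Eᶠ = Evaluation F
    module Eᴷ = Evaluation K
    module Iᶠ = Indicator.Semantics p N F p-prime ιp≡0ᶠ Kᶠ.2≤Q fermatᶠ
    module Iᴷ = Indicator.Semantics p N K p-prime ιp≡0ᴷ Kᶠ.2≤Q Kᶠ.fermat
  open Indicator p N using (_≐ᴾ_)
  open Fᶠ using (element; index; element-index)

  -- the variable with index i stands for the image of element i
  unitᴾ : Poly q
  unitᴾ = varᴾ (index Fᶠ.1#) ≐ᴾ 1ᴾ

  additiveᴾ multiplicativeᴾ : Fin q → Fin q → Poly q
  additiveᴾ       i j = varᴾ (index (element i Fᶠ.+ element j)) ≐ᴾ varᴾ i +ᴾ varᴾ j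
  multiplicativeᴾ i j = varᴾ (index (element i Fᶠ.* element j)) ≐ᴾ varᴾ i *ᴾ varᴾ j

  relationsᴾ : Fin q → Poly q
  relationsᴾ i = ∏ᴾ λ j → additiveᴾ i j *ᴾ multiplicativeᴾ i j

  homomorphismᴾ : Poly q
  homomorphismᴾ = unitᴾ *ᴾ ∏ᴾ relationsᴾ

  ⟦homomorphism⟧ᶠ-element : Eᶠ.⟦ homomorphismᴾ ⟧ element ≡ Fᶠ.1#
  ⟦homomorphism⟧ᶠ-element = begin
    Eᶠ.⟦ homomorphismᴾ ⟧ element                 ≡⟨ Eᶠ.⟦*⟧ unitᴾ _ element ⟩
    Eᶠ.⟦ unitᴾ ⟧ element Fᶠ.* Eᶠ.⟦ ∏ᴾ relationsᴾ ⟧ element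
      ≡⟨ cong₂ Fᶠ._*_ unit≡1 (Eᶠ.⟦∏⟧-one relationsᴾ element λ i → Eᶠ.⟦∏⟧-one _ element (factor≡1 i)) ⟩
    Fᶠ.1# Fᶠ.* Fᶠ.1#                             ≡⟨ Fᶠ.*-identityˡ Fᶠ.1# ⟩
    Fᶠ.1#                                        ∎
    where
    open ≡-Reasoning
    identity-solves : ∀ {x} {P : Poly q} → Eᶠ.⟦ P ⟧ element ≡ x → Eᶠ.⟦ varᴾ (index x) ⟧ element ≡ Eᶠ.⟦ P ⟧ element
    identity-solves {x} P≡x = trans (Eᶠ.⟦var⟧ (index x) element) (trans (element-index x) (sym P≡x))
    unit≡1 : Eᶠ.⟦ unitᴾ ⟧ element ≡ Fᶠ.1#
    unit≡1 = Iᶠ.⟦≐⟧-≡ _ 1ᴾ element (identity-solves (Eᶠ.⟦1⟧ element))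
    factor≡1 : ∀ i j → Eᶠ.⟦ additiveᴾ i j *ᴾ multiplicativeᴾ i j ⟧ element ≡ Fᶠ.1#
    factor≡1 i j = begin
      Eᶠ.⟦ additiveᴾ i j *ᴾ multiplicativeᴾ i j ⟧ element
        ≡⟨ Eᶠ.⟦*⟧ (additiveᴾ i j) (multiplicativeᴾ i j) element ⟩
      Eᶠ.⟦ additiveᴾ i j ⟧ element Fᶠ.* Eᶠ.⟦ multiplicativeᴾ i j ⟧ element
        ≡⟨ cong₂ Fᶠ._*_ (Iᶠ.⟦≐⟧-≡ _ _ element (identity-solves (Eᶠ.⟦var+var⟧ i j element)))
                        (Iᶠ.⟦≐⟧-≡ _ _ element (identity-solves (Eᶠ.⟦var*var⟧ i j element))) ⟩
      Fᶠ.1# Fᶠ.* Fᶠ.1#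
        ≡⟨ Fᶠ.*-identityˡ Fᶠ.1# ⟩
      Fᶠ.1# ∎
  module Solution (ρ : Fin q → Kᶠ.Carrier) (nonzero : Eᴷ.⟦ homomorphismᴾ ⟧ ρ ≢ Kᶠ.0#) where
    private
      factors≢0 = Eᴷ.⟦*⟧-nonzero unitᴾ _ ρ nonzero
      factor≢0 : ∀ i j → Eᴷ.⟦ additiveᴾ i j ⟧ ρ ≢ Kᶠ.0# × Eᴷ.⟦ multiplicativeᴾ i j ⟧ ρ ≢ Kᶠ.0#
      factor≢0 i j = Eᴷ.⟦*⟧-nonzero (additiveᴾ i j) (multiplicativeᴾ i j) ρ
                       (Eᴷ.⟦∏⟧-nonzero _ ρ (Eᴷ.⟦∏⟧-nonzero relationsᴾ ρ (proj₂ factors≢0) i) j)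

    ρ-1# : ρ (index Fᶠ.1#) ≡ Kᶠ.1#
    ρ-1# = trans (sym (Eᴷ.⟦var⟧ _ ρ)) (trans (Iᴷ.⟦≐⟧-nonzero _ 1ᴾ ρ (proj₁ factors≢0)) (Eᴷ.⟦1⟧ ρ))

    ρ-+ : ∀ i j → ρ (index (element i Fᶠ.+ element j)) ≡ ρ i Kᶠ.+ ρ j
    ρ-+ i j = trans (sym (Eᴷ.⟦var⟧ _ ρ))
                (trans (Iᴷ.⟦≐⟧-nonzero _ _ ρ (proj₁ (factor≢0 i j))) (Eᴷ.⟦var+var⟧ i j ρ))

    ρ-* : ∀ i j → ρ (index (element i Fᶠ.* element j)) ≡ ρ i Kᶠ.* ρ j
    ρ-* i j = trans (sym (Eᴷ.⟦var⟧ _ ρ))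
                (trans (Iᴷ.⟦≐⟧-nonzero _ _ ρ (proj₂ (factor≢0 i j))) (Eᴷ.⟦var*var⟧ i j ρ))

    fieldHom : FieldHom F K
    fieldHom = record
      { to    = ρ ∘ index
      ; to-1# = ρ-1#
      ; to-+  = λ x y → trans (cong (ρ ∘ index) (sym (cong₂ Fᶠ._+_ (element-index x) (element-index y))))
                              (ρ-+ (index x) (index y))
      ; to-*  = λ x y → trans (cong (ρ ∘ index) (sym (cong₂ Fᶠ._*_ (element-index x) (element-index y))))
                              (ρ-* (index x) (index y))
      }

  embedding : FieldHom F K
  embedding = Solution.fieldHom (proj₁ solution) (proj₂ solution)
    where
    char : ∀ n → Kᶠ.ι n ≡ Kᶠ.0# → Fᶠ.ι n ≡ Fᶠ.0#
    char n ιn≡0 = Fᶠ.ι-∣ {p} {n} (Kᶠ.ι-prime-∣ p-prime ιp≡0ᴷ ιn≡0) ιp≡0ᶠ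
    solution = Transfer.nonvanishing F K fermatᶠ char homomorphismᴾ element
                 (λ E≡0 → Fᶠ.0≢1 (trans (sym E≡0) ⟦homomorphism⟧ᶠ-element))

cycSuc : ∀ {n} → Fin n → Fin n
cycSuc {suc m} j with m ℕ.≟ toℕ j
... | yes _   = zero
... | no  m≢j = suc (lower₁ j m≢j)

τ⁻¹ : ∀ {A : Set} {n} → (Fin n → A) → Fin n → A
τ⁻¹ u = u ∘ cycSuc

τ⁻^ : ∀ {A : Set} {n} → ℕ → (Fin n → A) → Fin n → A
τ⁻^ zero    u = u
τ⁻^ (suc k) u = τ⁻^ k (τ⁻¹ u)

τ⁻^-cong : ∀ {A : Set} {n} k {u v : Fin n → A} → u ≗ v → τ⁻^ k u ≗ τ⁻^ k v
τ⁻^-cong zero    u≗v = u≗v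
τ⁻^-cong (suc k) u≗v = τ⁻^-cong k (u≗v ∘ cycSuc)

τ⁻^-∘ : ∀ {A B : Set} {n} (f : A → B) k (u : Fin n → A) → f ∘ τ⁻^ k u ≡ τ⁻^ k (f ∘ u)
τ⁻^-∘ f zero    u = refl
τ⁻^-∘ f (suc k) u = τ⁻^-∘ f k (τ⁻¹ u)

module Shift {Q : ℕ} (F : FiniteField Q) where
  cycPred-cycSuc : ∀ {n} (j : Fin n) → cycPred F (cycSuc j) ≡ j
  cycPred-cycSuc {suc m} j with m ℕ.≟ toℕ j
  ... | yes m≡j = Fin.toℕ-injective (trans (Fin.toℕ-fromℕ m) m≡j)
  ... | no  m≢j = Fin.inject₁-lower₁ j m≢j

  cycSuc-cycPred : ∀ {n} (j : Fin n) → cycSuc (cycPred F j) ≡ j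
  cycSuc-cycPred {suc m} zero with m ℕ.≟ toℕ (Fin.fromℕ m)
  ... | yes _   = refl
  ... | no  m≢m = contradiction (sym (Fin.toℕ-fromℕ m)) m≢m
  cycSuc-cycPred {suc m} (suc i) with m ℕ.≟ toℕ (Fin.inject₁ i)
  ... | yes m≡i = contradiction m≡i (Fin.toℕ-inject₁-≢ i)
  ... | no  m≢i = cong suc (Fin.lower₁-inject₁′ i m≢i)

  τ^-τ⁻^ : ∀ {n} k (u : Vec F n) → _≋_ F (τ^ F k (τ⁻^ k u)) u
  τ^-τ⁻^ zero    u j = refl
  τ^-τ⁻^ (suc k) u j = trans (τ^-τ⁻^ k (τ⁻¹ u) (cycPred F j)) (cong u (cycSuc-cycPred j))

  τ⁻^-τ^ : ∀ {n} k (u : Vec F n) → _≋_ F (τ⁻^ k (τ^ F k u)) u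
  τ⁻^-τ^ zero    u j = refl
  τ⁻^-τ^ (suc k) u j =
    trans (τ⁻^-cong k (λ i → cong (τ^ F k u) (cycPred-cycSuc i)) j) (τ⁻^-τ^ k u j)

module _ {Q : ℕ} {F : FiniteField Q} {n : ℕ} {U : Vec F n → Set} (U-subspace : IsSubspace F U) where
  open FieldProperties F using (module Sum)
  open IsSubspace U-subspace

  ∈-∑ : ∀ {m} (f : Fin m → Vec F n) → (∀ i → U (f i)) → U (λ j → Sum.sum (λ i → f i j))
  ∈-∑ {zero}  f _   = zero∈
  ∈-∑ {suc m} f f∈U = +-closed (f∈U zero) (∈-∑ (f ∘ suc) (f∈U ∘ suc))

module Pullback {q N : ℕ} {F : FiniteField q} {K : FiniteField N} (φ : FieldHom F K)
                {n : ℕ} (U : Vec K n → Set) (U-subspace : IsSubspace K U) where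
  open FieldHom φ
  open IsSubspace U-subspace

  pullback : Vec F n → Set
  pullback v = U (to ∘ v)

  pullback-subspace : IsSubspace F pullback
  pullback-subspace = record
    { respects = λ u≋v → respects (cong to ∘ u≋v)
    ; zero∈    = respects (λ _ → sym to-0#) zero∈
    ; +-closed = λ {u} {v} u∈ v∈ → respects (λ j → sym (to-+ (u j) (v j))) (+-closed u∈ v∈)
    ; ·-closed = λ c {u} u∈ → respects (λ j → sym (to-* c (u j))) (·-closed (to c) u∈)
    }

  pullback-covering : CyclicallyCovering K U → CyclicallyCovering F pullback
  pullback-covering U-covering v =
    let i , u , u∈U , τᵏu≋v = U-covering (to ∘ v)
        k = toℕ i
    in i , τ⁻^ k v
         , respects (λ j → sym (begin
             to (τ⁻^ k v j)          ≡⟨ cong (λ f → f j) (τ⁻^-∘ to k v) ⟩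
             τ⁻^ k (to ∘ v) j        ≡⟨ τ⁻^-cong k τᵏu≋v j ⟨
             τ⁻^ k (τ^ K k u) j      ≡⟨ Shift.τ⁻^-τ^ K k u j ⟩
             u j                     ∎)) u∈U
         , Shift.τ^-τ⁻^ F k v
    where open ≡-Reasoning

hZero-lift : ∀ {q N} {F : FiniteField q} {K : FiniteField N} → FieldHom F K → ∀ n → hZero F n → hZero K n
hZero-lift {F = F} {K} φ n hZeroF U U-subspace U-covering w =
  respects expansion (∈-∑ U-subspace _ λ i → ·-closed (w i) (F^n⊆U (Fᶠ.δ i)))
  where
  module Fᶠ = FieldProperties F
  module Kᶠ = FieldProperties K
  open FieldHom φ
  open IsSubspace U-subspace
  open Pullback φ U U-subspace

  F^n⊆U : ∀ v → U (to ∘ v)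
  F^n⊆U = hZeroF pullback pullback-subspace (pullback-covering U-covering)

  expansion : ∀ j → Kᶠ.Sum.sum (λ i → w i Kᶠ.* to (Fᶠ.δ i j)) ≡ w j
  expansion j = begin
    Kᶠ.Sum.sum (λ i → w i Kᶠ.* to (Fᶠ.δ i j)) ≡⟨ Kᶠ.∑-select _ j off-diagonal ⟩
    w j Kᶠ.* to (Fᶠ.δ j j)                  ≡⟨ cong (λ x → w j Kᶠ.* to x) (Fᶠ.δ-diagonal j) ⟩
    w j Kᶠ.* to Fᶠ.1#                       ≡⟨ cong (w j Kᶠ.*_) to-1# ⟩
    w j Kᶠ.* Kᶠ.1#                          ≡⟨ Kᶠ.*-identityʳ (w j) ⟩
    w j                                     ∎
    where
    open ≡-Reasoning
    off-diagonal : ∀ i → i ≢ j → w i Kᶠ.* to (Fᶠ.δ i j) ≡ Kᶠ.0#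
    off-diagonal i i≢j = begin
      w i Kᶠ.* to (Fᶠ.δ i j) ≡⟨ cong (λ x → w i Kᶠ.* to x) (Fᶠ.δ-offDiagonal i≢j) ⟩
      w i Kᶠ.* to Fᶠ.0#      ≡⟨ cong (w i Kᶠ.*_) to-0# ⟩
      w i Kᶠ.* Kᶠ.0#         ≡⟨ Kᶠ.zeroʳ (w i) ⟩
      Kᶠ.0#                  ∎

subfield-embedding : ∀ {q} m → IsPrimePower q → (F : FiniteField q) (K : FiniteField (q ℕ.^ m)) → FieldHom F K
subfield-embedding {q} m (p , k , p-prime , q≡pᵏ⁺¹) F K =
  Embedding.embedding F K p-prime ιp≡0ᶠ ιp≡0ᴷ (λ x → Fᶠ.fermat-^ x m)
  where
  module Fᶠ = FieldProperties F
  module Kᶠ = FieldProperties K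
  ιp≡0ᶠ = Fᶠ.ι-char-of-prime-power {p} {suc k} q≡pᵏ⁺¹
  ιp≡0ᴷ = Kᶠ.ι-char-of-prime-power {p} {suc k ℕ.* m} (trans (cong (ℕ._^ m) q≡pᵏ⁺¹) (^-*-assoc p (suc k) m))

open import Data.Nat using (_^_)

corollary4p2 : (q n t : ℕ) → IsPrimePower q → q % 2 ≡ 1 → n % 2 ≡ 1 → 1 ≤ t →
    (F : FiniteField q) → (K : FiniteField (q ^ (2 ^ t))) →
    hZero F n → hZero K n
corollary4p2 q n t q-prime-power _ _ _ F K = hZero-lift (subfield-embedding (2 ^ t) q-prime-power F K) n
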